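{- Assume the HDA $Q$ has non-repeating events. Let $q\in Q_n$, $i\in\{1,\dots,n\}$, and let $\pi$ be a rooted path ending at $s_i(q)$ (so that it extends to the path $\pi\xrightarrow{s_i}q$). Then $\lambda_i(q)\notin S_\pi$.
   Context: Precubical sets: families of disjoint sets $Q_n$ with face maps $s_k,t_k:Q_n\to Q_{n-1}$ ($k=1,\dots,n$) satisfying $\alpha_k\beta_\ell=\beta_{\ell-1}\alpha_k$ for $\alpha,\beta\in\{s,t\}$, $k<\ell$. An HDA is a finite precubical set with initial cell $I\in Q_0$. A step is $q'\xrightarrow{s_i}q$ with $s_iq=q'$, or $q\xrightarrow{t_i}q'$ with $t_iq=q'$; rooted paths are sequences of consecutive steps starting at $I$. Universal labels: $\approx$ is the equivalence on $Q_1$ generated by $(s_iq,t_iq)$, $q\in Q_2$, $i\in\{1,2\}$; $\lambda(e)$ the class of $e$; $\lambda_i(q)=\lambda(s_1\cdots s_{i-1}s_{i+1}\cdots s_n(q))$ for $q\in Q_n$. A sequential path is $v_0\xrightarrow{s}e_1\xrightarrow{t}v_1\cdots\xrightarrow{s}e_n\xrightarrow{t}v_n$ with $v_j\in Q_0$, $e_j\in Q_1$; $Q$ has non-repeating events if on every sequential path $\lambda(e_1),\dots,\lambda(e_n)$ are pairwise distinct. For a rooted path $\pi$: trivial path gives $(S,T)=(\emptyset,\emptyset)$; $\pi=\pi'\xrightarrow{s_i}q$ gives $S_\pi=S_{\pi'}\cup\{\lambda_i(q)\}$, $T_\pi=T_{\pi'}$; $\pi=\pi'\xrightarrow{t_i}t_i(q')$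 with $q'$ the end of $\pi'$ gives $S_\pi=S_{\pi'}$, $T_\pi=T_{\pi'}\cup\{\lambda_i(q')\}$. -}

module Defs where

open import Data.Nat using (ℕ; zero; suc; _>_; _≟_)
open import Data.Fin using (Fin; zero; suc; toℕ; fromℕ; inject₁; lower₁; _≤_)
open import Data.Empty using (⊥)
open import Data.Product using (Σ; ∃; _×_)
open import Data.List using (List; []; _∷_)
open import Data.List.Relation.Unary.AllPairs using (AllPairs)
open import Relation.Nullary using (¬_; yes; no)
open import Relation.Binary.PropositionalEquality using (_≡_)
open import Function.Bundles using (_↔_)

data Sgn : Set where
  src tgt : Sgn

-- Cell n = Q_n (disjointness is automatic by indexing).
-- face α n k q : for q ∈ Q_{n+1} and the 0-based index k : Fin (n+1),
-- this is α_{k+1}(q) ∈ Q_n  (so paper index = toℕ k + 1).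
record PrecubicalSet : Set₁ where
  field
    Cell : ℕ → Set
    face : Sgn → (n : ℕ) → Fin (suc n) → Cell (suc n) → Cell n
    -- α_k β_ℓ = β_{ℓ-1} α_k for k < ℓ (on Q_{n+2});
    -- written with paper indices k = toℕ k' + 1, ℓ = toℕ l' + 2, so k < ℓ ⇔ k' ≤ l'.
    cubical : ∀ (α β : Sgn) (n : ℕ) (k l : Fin (suc n)) → k ≤ l →
              (q : Cell (suc (suc n))) →
              face α n k (face β (suc n) (suc l) q)
                ≡ face β n l (face α (suc n) (inject₁ k) q)

record IsFinite (P : PrecubicalSet) : Set where
  open PrecubicalSet P
  field
    size   : ℕ → ℕ
    enum   : (n : ℕ) → Cell n ↔ Fin (size n)
    dim    : ℕ
    bounded : (n : ℕ) → n > dim → ¬ Cell n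

record HDA : Set₁ where
  field
    pc     : PrecubicalSet
    finite : IsFinite pc
    I      : PrecubicalSet.Cell pc 0
  open PrecubicalSet pc public

module _ (H : HDA) where
  open HDA H

  data _≈_ : Cell 1 → Cell 1 → Set where
    gen   : (q : Cell 2) (i : Fin 2) → face src 1 i q ≈ face tgt 1 i q
    ≈refl  : ∀ {e} → e ≈ e
    ≈sym   : ∀ {e f} → e ≈ f → f ≈ e
    ≈trans : ∀ {e f g} → e ≈ f → f ≈ g → e ≈ g

  -- lastEdge m q = s_1 s_2 ⋯ s_m (q) for q ∈ Q_{m+1}
  -- (applies s_m first, then s_{m-1}, …, s_1; i.e. repeatedly the second-to-top face).
  lastEdge : (m : ℕ) → Cell (suc m) → Cell 1
  lastEdge zero    q = q
  lastEdge (suc m) q = lastEdge m (face src (suc m) (inject₁ (fromℕ m)) q)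

  -- edgeOf n i q = s_1 ⋯ s_{i-1} s_{i+1} ⋯ s_n (q) for q ∈ Q_n and paper index i = toℕ i + 1:
  -- apply the top face s_n, s_{n-1}, …, s_{i+1}, then s_{i-1}, …, s_1.
  -- λ_i(q) is the ≈-class of edgeOf n i q.
  edgeOf : (n : ℕ) → Fin n → Cell n → Cell 1
  edgeOf (suc m) i q with m ≟ toℕ i
  ... | yes _ = lastEdge m q
  ... | no ne = edgeOf m (lower₁ i ne) (face src m (fromℕ m) q)

  data SeqPath : Cell 0 → Set where
    done : ∀ {v} → SeqPath v
    step : ∀ {v} (e : Cell 1) → face src 0 zero e ≡ v →
           SeqPath (face tgt 0 zero e) → SeqPath v

  seqEdges : ∀ {v} → SeqPath v → List (Cell 1)
  seqEdges done           = []
  seqEdges (step e _ p)   = e ∷ seqEdges p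

  NonRepeating : Set
  NonRepeating = ∀ (v : Cell 0) (p : SeqPath v) →
                 AllPairs (λ e f → ¬ (e ≈ f)) (seqEdges p)

  data Path : (n : ℕ) → Cell n → Set where
    start : Path 0 I
    up    : ∀ {n} (i : Fin (suc n)) (q : Cell (suc n)) →
            Path n (face src n i q) → Path (suc n) q
    down  : ∀ {n} {q : Cell (suc n)} (i : Fin (suc n)) →
            Path (suc n) q → Path n (face tgt n i q)

  -- S_π as a list of representative 1-cells (labels are their ≈-classes).
  Sset : ∀ {n q} → Path n q → List (Cell 1)
  Sset start        = []
  Sset (up i q π)   = edgeOf _ i q ∷ Sset π
  Sset (down i π)   = Sset π

  Tset : ∀ {n q} → Path n q → List (Cell 1)
  Tset start                 = []
  Tset (up i q π)            = Tset π
  Tset (down {q = q} i π)    = edgeOf _ i q ∷ Tset π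

-- Invariant: for a rooted path π ending at c ∈ Q_n there is a sequential path
-- (a walk) from I to the bottom vertex of c such that every label in S_π is the
-- label of an edge on the walk or one of the labels λ_j(c).  An up-step keeps
-- the walk, as a source face s_i q has the bottom vertex and (renumbered) labels
-- of q; a down-step q → t_i q appends the edge of q in direction i, whose label
-- is the one that ceases to be a label of the cell, while λ_j(t_i q) = λ_j(q).
-- If π ends at s_i q and λ_i(q) ∈ S_π, append the i-th edge E of q to the walk:
-- either the label already occurs on the walk, or it is some λ_j(s_i q) = λ_j(t_i q)
-- and appending also the j-th edge of t_i q repeats it; both contradict
-- non-repeating events.
module Submission where

open import Defs
open import Data.Nat using (ℕ; zero; suc; z≤n; s≤s) renaming (_≟_ to _≟ℕ_)
open import Data.Fin using (Fin; zero; suc; toℕ; fromℕ; inject₁; lower₁; _≤_; punchIn; punchOut; _≟_)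
open import Data.Fin.Properties
  using (punchIn-injective; punchIn-punchOut; punchOut-punchIn; punchInᵢ≢i; toℕ-injective; toℕ-fromℕ; inject₁-lower₁)
open import Data.Product using (Σ; _,_; _×_; proj₁; proj₂)
open import Data.Sum using (_⊎_; inj₁; inj₂)
open import Data.List using (List; []; _∷_; _++_)
open import Data.List.Properties using (++-assoc; ++-identityʳ)
open import Data.List.Relation.Unary.Any using (Any; here)
import Data.List.Relation.Unary.Any as Any
open import Data.List.Relation.Unary.Any.Properties using (++⁺ˡ; ++⁺ʳ)
open import Data.List.Relation.Unary.All using (All; []; _∷_; lookupAny)
import Data.List.Relation.Unary.All as All
open import Data.List.Relation.Unary.All.Properties using (++⁻ʳ)
open import Data.List.Relation.Unary.AllPairs using (AllPairs; []; _∷_)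
open import Data.Empty using (⊥-elim)
open import Relation.Nullary using (¬_; yes; no)
open import Relation.Binary.Bundles using (Setoid)
open import Relation.Binary.PropositionalEquality
open import Function using (_∘_)

-- Two distinct positions of an (n+2)-cube, put in the shape in which the
-- cubical identity of Defs is stated: positions k and l+1 with k ≤ l.
data Ordered {n : ℕ} : Fin (suc (suc n)) → Fin (suc (suc n)) → Set where
  below : (k l : Fin (suc n)) → k ≤ l → Ordered (inject₁ k) (suc l)
  above : (k l : Fin (suc n)) → k ≤ l → Ordered (suc l) (inject₁ k)

ordered : ∀ {n} (a b : Fin (suc (suc n))) → a ≢ b → Ordered a b
ordered zero    zero    a≢b = ⊥-elim (a≢b refl)
ordered zero    (suc l) _   = below zero l z≤n
ordered (suc l) zero    _   = above zero l z≤n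
ordered {zero}  (suc zero) (suc zero) a≢b = ⊥-elim (a≢b refl)
ordered {suc n} (suc a) (suc b) a≢b with ordered a b (a≢b ∘ cong suc)
... | below k l k≤l = below (suc k) (suc l) (s≤s k≤l)
... | above k l k≤l = above (suc k) (suc l) (s≤s k≤l)

punchOut-below : ∀ {n} (k l : Fin (suc n)) → k ≤ l → (ne : inject₁ k ≢ suc l) → punchOut ne ≡ l
punchOut-below zero    l       _         _  = refl
punchOut-below {suc n} (suc k) (suc l) (s≤s k≤l) ne = cong suc (punchOut-below k l k≤l _)

punchOut-above : ∀ {n} (k l : Fin (suc n)) → k ≤ l → (ne : suc l ≢ inject₁ k) → punchOut ne ≡ k
punchOut-above {zero}  zero    zero    _         _  = refl
punchOut-above {suc n} zero    l       _         _  = refl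
punchOut-above {suc n} (suc k) (suc l) (s≤s k≤l) ne = cong suc (punchOut-above k l k≤l _)

punchIn-comm : ∀ {n} (a b : Fin (suc (suc n))) (a≢b : a ≢ b) (b≢a : b ≢ a) (x : Fin n) →
               punchIn a (punchIn (punchOut a≢b) x) ≡ punchIn b (punchIn (punchOut b≢a) x)
punchIn-comm zero    zero    a≢b _ _ = ⊥-elim (a≢b refl)
punchIn-comm zero    (suc b) _   _ _ = refl
punchIn-comm (suc a) zero    _   _ _ = refl
punchIn-comm {suc n} (suc a) (suc b) _ _ zero    = refl
punchIn-comm {suc n} (suc a) (suc b) _ _ (suc x) = cong suc (punchIn-comm a b _ _ x)

-- A square has only two positions, so two distinct ones cannot both avoid a third.
punchIn-collision-Fin2 : (a b : Fin 2) (x y : Fin 1) → a ≢ b → punchIn a x ≢ punchIn b y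
punchIn-collision-Fin2 zero       zero       _    _    a≢b _ = a≢b refl
punchIn-collision-Fin2 zero       (suc zero) zero zero _   ()
punchIn-collision-Fin2 (suc zero) zero       zero zero _   ()
punchIn-collision-Fin2 (suc zero) (suc zero) _    _    a≢b _ = a≢b refl

-- The removals performed by lastEdge and edgeOf in Defs, in punchIn form.
punchIn-inject₁-fromℕ : ∀ n → punchIn (inject₁ (fromℕ n)) (fromℕ n) ≡ fromℕ (suc n)
punchIn-inject₁-fromℕ zero    = refl
punchIn-inject₁-fromℕ (suc n) = cong suc (punchIn-inject₁-fromℕ n)

punchIn-fromℕ : ∀ {n} (x : Fin n) → punchIn (fromℕ n) x ≡ inject₁ x
punchIn-fromℕ zero    = refl
punchIn-fromℕ (suc x) = cong suc (punchIn-fromℕ x)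

another : ∀ {n} (j : Fin (suc (suc n))) → Σ (Fin (suc (suc n))) (_≢ j)
another zero    = suc zero , λ ()
another (suc j) = zero , λ ()

AllPairs-++⁻ : ∀ {A : Set} {R : A → A → Set} xs {ys} → AllPairs R (xs ++ ys) →
               All (λ x → All (R x) ys) xs
AllPairs-++⁻ []       _           = []
AllPairs-++⁻ (x ∷ xs) (x∼ ∷ rest) = ++⁻ʳ xs x∼ ∷ AllPairs-++⁻ xs rest

module _ (H : HDA) where
  open HDA H

  face-comm : ∀ α β n (a b : Fin (suc (suc n))) (a≢b : a ≢ b) (b≢a : b ≢ a) (q : Cell (suc (suc n))) →
              face β n (punchOut a≢b) (face α (suc n) a q) ≡ face α n (punchOut b≢a) (face β (suc n) b q)
  face-comm α β n a b a≢b b≢a q with ordered a b a≢b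
  ... | below k l k≤l = begin
    face β n (punchOut a≢b) (face α (suc n) (inject₁ k) q) ≡⟨ cong (λ x → face β n x _) (punchOut-below k l k≤l a≢b) ⟩
    face β n l (face α (suc n) (inject₁ k) q)            ≡⟨ cubical α β n k l k≤l q ⟨
    face α n k (face β (suc n) (suc l) q)                ≡⟨ cong (λ x → face α n x _) (punchOut-above k l k≤l b≢a) ⟨
    face α n (punchOut b≢a) (face β (suc n) (suc l) q)   ∎
    where open ≡-Reasoning
  ... | above k l k≤l = begin
    face β n (punchOut a≢b) (face α (suc n) (suc l) q)   ≡⟨ cong (λ x → face β n x _) (punchOut-above k l k≤l a≢b) ⟩
    face β n k (face α (suc n) (suc l) q)                ≡⟨ cubical β α n k l k≤l q ⟩
    face α n l (face β (suc n) (inject₁ k) q)            ≡⟨ cong (λ x → face α n x _) (punchOut-below k l k≤l b≢a) ⟨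
    face α n (punchOut b≢a) (face β (suc n) (inject₁ k) q) ∎
    where open ≡-Reasoning

  face-comm-punchIn : ∀ α β n (p : Fin (suc (suc n))) (j : Fin (suc n)) (q : Cell (suc (suc n))) →
                      face α n j (face β (suc n) p q)
                        ≡ face β n (punchOut (punchInᵢ≢i p j)) (face α (suc n) (punchIn p j) q)
  face-comm-punchIn α β n p j q =
    trans (cong (λ x → face α n x (face β (suc n) p q)) (sym (punchOut-punchIn p)))
          (face-comm β α n p (punchIn p j) (punchInᵢ≢i p j ∘ sym) (punchInᵢ≢i p j) q)

  -- IsEdge n j q e: e is obtained from q ∈ Q_{n+1} by taking source faces in
  -- all directions except j, in any order.
  data IsEdge : (n : ℕ) → Fin (suc n) → Cell (suc n) → Cell 1 → Set where
    base : ∀ q → IsEdge 0 zero q q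
    peel : ∀ {n j q e} (p : Fin (suc (suc n))) (j′ : Fin (suc n)) → punchIn p j′ ≡ j →
           IsEdge n j′ (face src (suc n) p q) e → IsEdge (suc n) j q e

  lastEdge-isEdge : ∀ m q → IsEdge m (fromℕ m) q (lastEdge H m q)
  lastEdge-isEdge zero    q = base q
  lastEdge-isEdge (suc m) q =
    peel (inject₁ (fromℕ m)) (fromℕ m) (punchIn-inject₁-fromℕ m) (lastEdge-isEdge m _)

  edgeOf-isEdge : ∀ m j q → IsEdge m j q (edgeOf H (suc m) j q)
  edgeOf-isEdge m j q with m ≟ℕ toℕ j
  ... | yes m≡j = subst (λ k → IsEdge m k q (lastEdge H m q))
                        (toℕ-injective (trans (toℕ-fromℕ m) m≡j)) (lastEdge-isEdge m q)
  edgeOf-isEdge zero    zero q | no m≢j = ⊥-elim (m≢j refl)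
  edgeOf-isEdge (suc m) j    q | no m≢j =
    peel (fromℕ (suc m)) (lower₁ j m≢j) (trans (punchIn-fromℕ _) (inject₁-lower₁ j m≢j))
         (edgeOf-isEdge m (lower₁ j m≢j) _)

  -- Two ways of peeling off distinct first directions p₁, p₂ that keep the same
  -- direction of q lead to a common edge: peel off the other one next.
  shared-edge : ∀ n {q : Cell (suc (suc n))} {p₁ p₂ j₁ j₂} → p₁ ≢ p₂ → punchIn p₁ j₁ ≡ punchIn p₂ j₂ →
                Σ (Cell 1) λ e → IsEdge n j₁ (face src (suc n) p₁ q) e × IsEdge n j₂ (face src (suc n) p₂ q) e
  shared-edge zero {p₁ = p₁} {p₂} {j₁} {j₂} p₁≢p₂ same =
    ⊥-elim (punchIn-collision-Fin2 p₁ p₂ j₁ j₂ p₁≢p₂ same)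
  shared-edge (suc m) {q} {p₁} {p₂} {j₁} {j₂} p₁≢p₂ same = e₀ , route₁ , route₂
    where
      a = punchOut p₁≢p₂
      b = punchOut (p₁≢p₂ ∘ sym)
      a≢j₁ : a ≢ j₁
      a≢j₁ a≡j₁ = punchInᵢ≢i p₂ j₂ (sym (trans (sym (punchIn-punchOut p₁≢p₂))
                                         (trans (cong (punchIn p₁) a≡j₁) same)))
      k = punchOut a≢j₁
      c = face src (suc m) a (face src (suc (suc m)) p₁ q)
      e₀ = edgeOf H (suc m) k c
      route₁ = peel a k (punchIn-punchOut a≢j₁) (edgeOf-isEdge m k c)
      b-k≡j₂ : punchIn b k ≡ j₂
      b-k≡j₂ = punchIn-injective p₂ _ _
        (trans (sym (punchIn-comm p₁ p₂ p₁≢p₂ (p₁≢p₂ ∘ sym) k))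
               (trans (cong (punchIn p₁) (punchIn-punchOut a≢j₁)) same))
      route₂ = peel b k b-k≡j₂
        (subst (λ d → IsEdge m k d e₀) (face-comm src src (suc m) p₁ p₂ p₁≢p₂ (p₁≢p₂ ∘ sym) q)
               (edgeOf-isEdge m k c))

  isEdge-unique : ∀ {n j q e e′} → IsEdge n j q e → IsEdge n j q e′ → e ≡ e′
  isEdge-unique (base _) (base _) = refl
  isEdge-unique {suc n} (peel p₁ j₁ eq₁ d₁) (peel p₂ j₂ eq₂ d₂) with p₁ ≟ p₂
  ... | yes refl with punchIn-injective p₁ j₁ j₂ (trans eq₁ (sym eq₂))
  ...   | refl = isEdge-unique d₁ d₂
  isEdge-unique {suc n} (peel p₁ j₁ eq₁ d₁) (peel p₂ j₂ eq₂ d₂) | no p₁≢p₂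
    with shared-edge n p₁≢p₂ (trans eq₁ (sym eq₂))
  ... | e₀ , r₁ , r₂ = trans (isEdge-unique d₁ r₁) (sym (isEdge-unique d₂ r₂))

  edgeOf-src : ∀ n (i : Fin (suc n)) (q : Cell (suc n)) (j : Fin n) →
               edgeOf H n j (face src n i q) ≡ edgeOf H (suc n) (punchIn i j) q
  edgeOf-src (suc m) i q j =
    isEdge-unique (peel i j refl (edgeOf-isEdge m j (face src (suc m) i q)))
                  (edgeOf-isEdge (suc m) (punchIn i j) q)

  labels : Setoid _ _
  labels = record
    { Carrier       = Cell 1
    ; _≈_           = _≈_ H
    ; isEquivalence = record { refl = ≈refl ; sym = ≈sym ; trans = ≈trans }
    }

  ≡⇒≈ : ∀ {e f} → e ≡ f → _≈_ H e f
  ≡⇒≈ = Setoid.reflexive labels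

  -- The edges of a target face t_i q carry the labels of the corresponding
  -- edges of q: in dimension 2 this is the generator of ≈, in higher
  -- dimensions we first pass to a source face s_x of t_i q.
  edgeOf-tgt : ∀ n (i : Fin (suc n)) (q : Cell (suc n)) (j : Fin n) →
               _≈_ H (edgeOf H n j (face tgt n i q)) (edgeOf H (suc n) (punchIn i j) q)
  edgeOf-tgt (suc zero) zero       q zero = ≈sym (gen q zero)
  edgeOf-tgt (suc zero) (suc zero) q zero = ≈sym (gen q (suc zero))
  edgeOf-tgt (suc (suc m)) i q j = begin
    edgeOf H (suc (suc m)) j (face tgt (suc (suc m)) i q)
      ≡⟨ cong (λ y → edgeOf H (suc (suc m)) y (face tgt (suc (suc m)) i q)) (punchIn-punchOut x≢j) ⟨
    edgeOf H (suc (suc m)) (punchIn x k) (face tgt (suc (suc m)) i q)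
      ≡⟨ edgeOf-src (suc m) x (face tgt (suc (suc m)) i q) k ⟨
    edgeOf H (suc m) k (face src (suc m) x (face tgt (suc (suc m)) i q))
      ≡⟨ cong (edgeOf H (suc m) k) (face-comm-punchIn src tgt (suc m) i x q) ⟩
    edgeOf H (suc m) k (face tgt (suc m) b (face src (suc (suc m)) p q))
      ≈⟨ edgeOf-tgt (suc m) b (face src (suc (suc m)) p q) k ⟩
    edgeOf H (suc (suc m)) (punchIn b k) (face src (suc (suc m)) p q)
      ≡⟨ edgeOf-src (suc (suc m)) p q (punchIn b k) ⟩
    edgeOf H (suc (suc (suc m))) (punchIn p (punchIn b k)) q
      ≡⟨ cong (λ y → edgeOf H (suc (suc (suc m))) y q) p-b≡i-x ⟩
    edgeOf H (suc (suc (suc m))) (punchIn i j) q ∎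
    where
      open import Relation.Binary.Reasoning.Setoid labels
      x = proj₁ (another j)
      x≢j = proj₂ (another j)
      k = punchOut x≢j
      p = punchIn i x
      b = punchOut (punchInᵢ≢i i x)
      p-b≡i-x : punchIn p (punchIn b k) ≡ punchIn i j
      p-b≡i-x = trans (punchIn-comm p i (punchInᵢ≢i i x) (punchInᵢ≢i i x ∘ sym) k)
                      (cong (punchIn i) (trans (cong (λ y → punchIn y k) (punchOut-punchIn i))
                                               (punchIn-punchOut x≢j)))

  opposite-faces-labels : ∀ n (i : Fin (suc n)) (q : Cell (suc n)) (j : Fin n) →
                          _≈_ H (edgeOf H n j (face src n i q)) (edgeOf H n j (face tgt n i q))
  opposite-faces-labels n i q j = ≈trans (≡⇒≈ (edgeOf-src n i q j)) (≈sym (edgeOf-tgt n i q j))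

  bottom : ∀ n → Cell n → Cell 0
  bottom zero    c = c
  bottom (suc n) c = bottom n (face src n zero c)

  bottom-face : ∀ n (i : Fin (suc n)) (q : Cell (suc n)) → bottom n (face src n i q) ≡ bottom (suc n) q
  bottom-face n       zero    q = refl
  bottom-face (suc n) (suc l) q =
    trans (cong (bottom n) (cubical src src n zero l z≤n q)) (bottom-face n l (face src (suc n) zero q))

  isEdge-source : ∀ {n j q e} → IsEdge n j q e → face src 0 zero e ≡ bottom (suc n) q
  isEdge-source (base q) = refl
  isEdge-source {suc n} {q = q} (peel p j′ refl d) = trans (isEdge-source d) (bottom-face (suc n) p q)

  isEdge-target : ∀ {n j q e} → IsEdge n j q e → face tgt 0 zero e ≡ bottom n (face tgt n j q)
  isEdge-target (base q) = refl
  isEdge-target {suc n} {q = q} (peel p j′ refl d) =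
    trans (isEdge-target d)
          (trans (cong (bottom n) (face-comm-punchIn tgt src n p j′ q))
                 (bottom-face n _ (face tgt (suc n) (punchIn p j′) q)))

  data Walk : List (Cell 1) → Cell 0 → Set where
    initial : Walk [] I
    extend  : ∀ {es v} → Walk es v → (e : Cell 1) → face src 0 zero e ≡ v →
              Walk (es ++ e ∷ []) (face tgt 0 zero e)

  walk-then-path : ∀ {es v} → Walk es v → (sp : SeqPath H v) →
                   Σ (SeqPath H I) λ r → seqEdges H r ≡ es ++ seqEdges H sp
  walk-then-path initial          sp = sp , refl
  walk-then-path (extend w e src≡) sp with walk-then-path w (step e src≡ sp)
  ... | r , edges≡ = r , trans edges≡ (sym (++-assoc _ (e ∷ []) (seqEdges H sp)))

  walk-distinct : NonRepeating H → ∀ {es v} → Walk es v → AllPairs (λ e f → ¬ _≈_ H e f) es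
  walk-distinct nonRep {es} w with walk-then-path w done
  ... | r , edges≡ = subst (AllPairs _) (trans edges≡ (++-identityʳ es)) (nonRep I r)

  walk-along-edge : ∀ {es n} {q : Cell (suc n)} (i : Fin (suc n)) → Walk es (bottom (suc n) q) →
                    Walk (es ++ edgeOf H (suc n) i q ∷ []) (bottom n (face tgt n i q))
  walk-along-edge {n = n} {q} i w =
    subst (Walk _) (isEdge-target (edgeOf-isEdge n i q))
          (extend w (edgeOf H (suc n) i q) (isEdge-source (edgeOf-isEdge n i q)))

  fresh-edge-label : NonRepeating H → ∀ {es n} {q : Cell (suc n)} (i : Fin (suc n)) →
                     Walk es (bottom (suc n) q) → ¬ Any (λ x → _≈_ H x (edgeOf H (suc n) i q)) es
  fresh-edge-label nonRep {es} i w onWalk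
    with lookupAny (AllPairs-++⁻ es (walk-distinct nonRep (walk-along-edge i w))) onWalk
  ... | x≉E ∷ [] , x≈E = x≉E x≈E

  next-edge-label : NonRepeating H → ∀ {es n} {q : Cell (suc n)} (i : Fin (suc n)) (j : Fin n) →
                    Walk es (bottom (suc n) q) →
                    ¬ _≈_ H (edgeOf H (suc n) i q) (edgeOf H n j (face tgt n i q))
  next-edge-label nonRep {es} {suc m} i j w
    with ++⁻ʳ es (AllPairs-++⁻ (es ++ _ ∷ []) (walk-distinct nonRep (walk-along-edge j (walk-along-edge i w))))
  ... | (E≉G ∷ []) ∷ [] = E≉G

  Accounted : List (Cell 1) → (n : ℕ) → Cell n → Cell 1 → Set
  Accounted es n c e = Any (_≈_ H e) es ⊎ Σ (Fin n) λ j → _≈_ H e (edgeOf H n j c)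

  invariant : ∀ {n c} (π : Path H n c) →
              Σ (List (Cell 1)) λ es → Walk es (bottom n c) × All (Accounted es n c) (Sset H π)
  invariant start = [] , initial , []
  invariant (up {n} i q π) with invariant π
  ... | es , w , accounted = es , subst (Walk es) (bottom-face n i q) w , inj₂ (i , ≈refl) ∷ All.map lift accounted
    where
      lift : ∀ {e} → Accounted es n (face src n i q) e → Accounted es (suc n) q e
      lift (inj₁ onWalk)   = inj₁ onWalk
      lift (inj₂ (j , e≈)) = inj₂ (punchIn i j , ≈trans e≈ (≡⇒≈ (edgeOf-src n i q j)))
  invariant (down {n} {q} i π) with invariant π
  ... | es , w , accounted = _ , walk-along-edge i w , All.map lower accounted
    where
      lower : ∀ {e} → Accounted es (suc n) q e → Accounted (es ++ edgeOf H (suc n) i q ∷ []) n (face tgt n i q) e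
      lower (inj₁ onWalk) = inj₁ (++⁺ˡ onWalk)
      lower (inj₂ (j , e≈)) with i ≟ j
      ... | yes refl = inj₁ (++⁺ʳ es (here e≈))
      ... | no i≢j   = inj₂ (punchOut i≢j , ≈trans e≈ (≈sym tgt≈))
        where
          tgt≈ : _≈_ H (edgeOf H n (punchOut i≢j) (face tgt n i q)) (edgeOf H (suc n) j q)
          tgt≈ = subst (λ k → _≈_ H (edgeOf H n (punchOut i≢j) (face tgt n i q)) (edgeOf H (suc n) k q))
                       (punchIn-punchOut i≢j) (edgeOf-tgt n i q (punchOut i≢j))

-- The label found in S_π lies on the walk or among the labels of s_i q; either
-- way a sequential path through the i-th edge of q repeats it.
corollary4p13 : (H : HDA) → NonRepeating H →
    (n : ℕ) (q : HDA.Cell H (suc n)) (i : Fin (suc n)) →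
    (π : Path H n (HDA.face H src n i q)) →
    ¬ Any (λ e → _≈_ H e (edgeOf H (suc n) i q)) (Sset H π)
corollary4p13 H nonRep n q i π inS with invariant H π
... | es , w , accounted
    with lookupAny accounted inS | subst (Walk H es) (bottom-face H n i q) w
... | inj₁ onWalk , e≈E | walk =
  fresh-edge-label H nonRep i walk (Any.map (λ e≈x → ≈trans (≈sym e≈x) e≈E) onWalk)
... | inj₂ (j , e≈) , e≈E | walk =
  next-edge-label H nonRep i j walk (≈trans (≈sym e≈E) (≈trans e≈ (opposite-faces-labels H n i q j)))
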